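{- For every integer $n\ge 2$, the path $P_n$ on $n$ vertices satisfies $IDI(P_n)=2$.
   Context: For a connected graph $G=(V,E)$ of diameter $d$ and $f:V\to\mathbb{R}$, the string of $v$ under $f$ is the $d$-vector whose $i$-th coordinate is $\sum_{w:\ d(v,w)=i} f(w)$ ($d(\cdot,\cdot)$ = graph distance). $IDI(G)$ is the minimum $k$ such that some $f$ with $|f(V)|=k$ gives all vertices pairwise distinct strings.
   Formalization: The functions f that define the strings and IDI take values in ℚ instead of ℝ. -}

module Defs where

open import Data.Nat using (ℕ; zero; suc; _+_; _⊔_; _≤_)
open import Data.Fin using (Fin; toℕ)
open import Data.Fin.Properties using () renaming (_≟_ to _≟ᶠ_)
open import Data.Bool using (Bool; _∨_; _∧_; not)
open import Data.Bool.ListAction using (any)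
open import Data.List using (List; length; filter; map; upTo; foldr; allFin; deduplicate; concatMap)
open import Data.Vec using (Vec; tabulate)
open import Data.Product using (Σ; _×_)
open import Relation.Nullary using (¬_)
open import Relation.Nullary.Decidable using (isYes; ¬?)
open import Relation.Binary.PropositionalEquality using (_≡_; _≢_)
open import Data.Rational using (ℚ; 0ℚ) renaming (_+_ to _+ℚ_)
open import Data.Rational.Properties using () renaming (_≟_ to _≟ℚ_)

record Graph (n : ℕ) : Set where
  field
    adj : Fin n → Fin n → Bool

open Graph public

module _ {n : ℕ} (G : Graph n) where

  reach : ℕ → Fin n → Fin n → Bool
  reach zero v w = isYes (v ≟ᶠ w)
  reach (suc k) v w = reach k v w ∨ any (λ u → reach k v u ∧ adj G u w) (allFin n)

  Connected : Set
  Connected = ∀ v w → reach n v w ≡ Data.Bool.true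

  -- Graph distance: the least k with reach k v w (for connected G),
  -- computed as the number of k < n with ¬ reach k v w (reach is monotone in k).
  dist : Fin n → Fin n → ℕ
  dist v w = length (filter (λ k → ¬? (Data.Bool._≟_ (reach k v w) Data.Bool.true)) (upTo n))

  diam : ℕ
  diam = foldr _⊔_ 0 (concatMap (λ v → map (dist v) (allFin n)) (allFin n))

  sumℚ : List ℚ → ℚ
  sumℚ = foldr _+ℚ_ 0ℚ

  -- string of v under f: the d-vector whose i-th coordinate (i = 1..d)
  -- is the sum of f(w) over w with d(v,w) = i
  string : (Fin n → ℚ) → Fin n → Vec ℚ diam
  string f v = tabulate (λ (i : Fin diam) →
    sumℚ (map f (filter (λ w → dist v w Data.Nat.≟ suc (toℕ i)) (allFin n))))

  Distinguishing : (Fin n → ℚ) → Set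
  Distinguishing f = ∀ v w → v ≢ w → string f v ≢ string f w

imageSize : {n : ℕ} → (Fin n → ℚ) → ℕ
imageSize {n} f = length (deduplicate _≟ℚ_ (map f (allFin n)))

IDI≡ : {n : ℕ} → Graph n → ℕ → Set
IDI≡ G k = Σ (_ → ℚ) (λ f → imageSize f ≡ k × Distinguishing G f)
         × (∀ f → Distinguishing G f → k ≤ imageSize f)

path : (n : ℕ) → Graph n
path n = record { adj = λ i j → isYes (suc (toℕ i) Data.Nat.≟ toℕ j) ∨ isYes (suc (toℕ j) Data.Nat.≟ toℕ i) }

{-# OPTIONS --safe #-}
-- On the path, dist u v = |u - v|.  Under the indicator of the end 0, the string of a vertex
-- v ≥ 1 has its only nonzero entry at coordinate v, while the string of 0 vanishes; so
-- indicator₀ distinguishes with two values.  A function with a single value is constant, and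
-- then both ends, which have exactly one vertex at each distance 1, …, n - 1, get equal strings.
module Submission where

open import Defs
open import Data.Nat using (ℕ; _≤_)
open import Data.Nat as ℕ using (zero; suc; _+_; _<_; _⊔_; ∣_-_∣; z≤n; s≤s; s≤s⁻¹; _<?_)
open import Data.Nat.Properties as ℕ using (≤-reflexive; m≤n⇒m<n∨m≡n)
open import Data.Fin as Fin using (Fin; toℕ; fromℕ; fromℕ<; opposite)
open import Data.Fin.Properties
  using (toℕ-injective; toℕ-fromℕ; toℕ-fromℕ<; toℕ<n; toℕ≤pred[n]; opposite-prop; opposite-involutive; 0≢1+n; suc-injective)
open import Data.Bool using (T; true)
open import Data.Bool.Properties using (T-≡; T-∨; T-∧)
open import Data.List using ([]; _∷_; _++_; length; map; filter; foldr; allFin; upTo; tabulate; deduplicate)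
open import Data.List.Properties
  using (filter-accept; filter-reject; filter-none; filter-all; filter-++; filter-≐; ++-identityʳ; upTo-∷ʳ; length-upTo)
open import Data.List.Membership.Propositional using (_∈_; lose)
open import Data.List.Membership.Propositional.Properties using (∈-allFin; ∈-map⁺; ∈-concatMap⁺; ∈-deduplicate⁺)
open import Data.List.Relation.Unary.Any using (here; there; satisfied)
open import Data.List.Relation.Unary.Any.Properties using (any⁺; any⁻)
open import Data.List.Relation.Unary.All as All using (All)
open import Data.List.Relation.Unary.All.Properties using (tabulate⁺; map⁺; filter⁺; all-upTo; deduplicate⁺)
open import Data.Vec using (lookup)
open import Data.Vec.Properties using (lookup∘tabulate; tabulate-cong)
open import Data.Product as Product using (∃-syntax; _×_; _,_)
open import Data.Sum as Sum using (_⊎_; inj₁; inj₂)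
open import Data.Rational using (ℚ; 0ℚ; 1ℚ) renaming (_+_ to _+ℚ_)
open import Data.Rational.Properties as ℚ using (1≢0)
open import Data.Empty using (⊥-elim)
open import Function using (_∘_; id; _⇔_; mk⇔; Equivalence)
open import Relation.Nullary using (¬_; yes; no)
open import Relation.Nullary.Decidable using (¬?; toWitness; fromWitness)
open import Relation.Unary using (Decidable; _≐_)
open import Relation.Binary.PropositionalEquality
  using (_≡_; _≢_; refl; sym; trans; cong; cong₂; subst; module ≡-Reasoning)

open Equivalence using (to; from)

module _ {A : Set} {P : A → Set} (P? : Decidable P) where

  filter-tabulate-unique : ∀ {n} (g : Fin n → A) {a} → P (g a) → (∀ i → P (g i) → i ≡ a) →
                           filter P? (tabulate g) ≡ g a ∷ []
  filter-tabulate-unique g {Fin.zero} Pga unique =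
    trans (filter-accept P? Pga)
          (cong (g Fin.zero ∷_) (filter-none P? (tabulate⁺ (λ i → 0≢1+n ∘ sym ∘ unique (Fin.suc i)))))
  filter-tabulate-unique g {Fin.suc a} Pga unique =
    trans (filter-reject P? (0≢1+n ∘ unique Fin.zero))
          (filter-tabulate-unique (g ∘ Fin.suc) Pga (λ i → suc-injective ∘ unique (Fin.suc i)))

∈-length≤1⇒≡ : ∀ {A : Set} {x y : A} {xs} → x ∈ xs → y ∈ xs → length xs ≤ 1 → x ≡ y
∈-length≤1⇒≡ {xs = _ ∷ []} (here refl) (here refl) _ = refl
∈-length≤1⇒≡ {xs = _ ∷ _ ∷ _} _ _ (s≤s ())

≤-foldr-⊔ : ∀ {m ms} → m ∈ ms → m ≤ foldr _⊔_ 0 ms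
≤-foldr-⊔ {ms = m ∷ _} (here refl) = ℕ.m≤m⊔n m _
≤-foldr-⊔ {ms = m ∷ _} (there m′∈ms) = ℕ.m≤n⇒m≤o⊔n m (≤-foldr-⊔ m′∈ms)

filter-<-upTo : ∀ {d n} → d ≤ n → filter (_<? d) (upTo n) ≡ upTo d
filter-<-upTo {n = zero} z≤n = refl
filter-<-upTo {d} {suc n} d≤1+n with m≤n⇒m<n∨m≡n d≤1+n
... | inj₂ refl = filter-all (_<? d) (all-upTo d)
... | inj₁ d<1+n = begin
  filter (_<? d) (upTo (suc n))                      ≡⟨ cong (filter (_<? d)) (upTo-∷ʳ n) ⟨
  filter (_<? d) (upTo n ++ n ∷ [])                  ≡⟨ filter-++ (_<? d) (upTo n) (n ∷ []) ⟩
  filter (_<? d) (upTo n) ++ filter (_<? d) (n ∷ []) ≡⟨ cong₂ _++_ (filter-<-upTo d≤n) (filter-reject (_<? d) (ℕ.≤⇒≯ d≤n)) ⟩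
  upTo d ++ []                                       ≡⟨ ++-identityʳ (upTo d) ⟩
  upTo d                                             ∎
  where
  open ≡-Reasoning
  d≤n = s≤s⁻¹ d<1+n

sum-zeros : ∀ {A : Set} (f : A → ℚ) {xs} → All (λ x → f x ≡ 0ℚ) xs → foldr _+ℚ_ 0ℚ (map f xs) ≡ 0ℚ
sum-zeros f All.[] = refl
sum-zeros f (fx≡0 All.∷ fxs≡0) = trans (cong₂ _+ℚ_ fx≡0 (sum-zeros f fxs≡0)) (ℚ.+-identityʳ 0ℚ)

module _ {n : ℕ} (G : Graph n) where

  reach-mono : ∀ {k v w} → T (reach G k v w) → T (reach G (suc k) v w)
  reach-mono r = from T-∨ (inj₁ r)

  reach-step : ∀ {k v u w} → T (reach G k v u) → T (adj G u w) → T (reach G (suc k) v w)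
  reach-step {u = u} r a = from T-∨ (inj₂ (any⁺ _ (lose (∈-allFin u) (from T-∧ (r , a)))))

  reach-suc⁻ : ∀ {k v w} → T (reach G (suc k) v w) →
               T (reach G k v w) ⊎ ∃[ u ] (T (reach G k v u) × T (adj G u w))
  reach-suc⁻ r = Sum.map₂ (Product.map₂ (to T-∧) ∘ satisfied ∘ any⁻ _ (allFin n)) (to T-∨ r)

  dist-unique : ∀ {v w d} → d ≤ n → (∀ k → T (reach G k v w) ⇔ d ≤ k) → dist G v w ≡ d
  dist-unique {v} {w} {d} d≤n reach⇔ = begin
    dist G v w                        ≡⟨ cong length (filter-≐ _ (_<? d) unreached⇔below (upTo n)) ⟩
    length (filter (_<? d) (upTo n))  ≡⟨ cong length (filter-<-upTo d≤n) ⟩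
    length (upTo d)                   ≡⟨ length-upTo d ⟩
    d                                 ∎
    where
    open ≡-Reasoning
    unreached⇔below : (λ k → ¬ reach G k v w ≡ true) ≐ (_< d)
    unreached⇔below = (λ ¬r → ℕ.≰⇒> (¬r ∘ to T-≡ ∘ from (reach⇔ _)))
                    , (λ k<d r → ℕ.<⇒≱ k<d (to (reach⇔ _) (from T-≡ r)))

  dist≤diam : ∀ v w → dist G v w ≤ diam G
  dist≤diam v w =
    ≤-foldr-⊔ (∈-concatMap⁺ (λ u → map (dist G u) (allFin n)) (lose (∈-allFin v) (∈-map⁺ (dist G v) (∈-allFin w))))

  classSum : (Fin n → ℚ) → Fin n → ℕ → ℚ
  classSum f v j = sumℚ G (map f (filter (λ w → dist G v w ℕ.≟ j) (allFin n)))

  string-≡⁺ : ∀ {f v w} → (∀ j → classSum f v j ≡ classSum f w j) → string G f v ≡ string G f w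
  string-≡⁺ same = tabulate-cong (λ i → same (suc (toℕ i)))

  string-≡⁻ : ∀ {f v w k} → string G f v ≡ string G f w → k < diam G →
              classSum f v (suc k) ≡ classSum f w (suc k)
  string-≡⁻ {f} {v} {w} {k} same k<diam = begin
    classSum f v (suc k)        ≡⟨ cong (classSum f v ∘ suc) (toℕ-fromℕ< k<diam) ⟨
    classSum f v (suc (toℕ i))  ≡⟨ lookup∘tabulate _ i ⟨
    lookup (string G f v) i     ≡⟨ cong (λ s → lookup s i) same ⟩
    lookup (string G f w) i     ≡⟨ lookup∘tabulate _ i ⟩
    classSum f w (suc (toℕ i))  ≡⟨ cong (classSum f w ∘ suc) (toℕ-fromℕ< k<diam) ⟩
    classSum f w (suc k)        ∎
    where
    open ≡-Reasoning
    i = fromℕ< k<diam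

indicator₀ : ∀ {n} → Fin (suc n) → ℚ
indicator₀ Fin.zero = 1ℚ
indicator₀ (Fin.suc _) = 0ℚ

module _ {n : ℕ} (G : Graph (suc n)) where

  private
    nonzero-vertices-vanish : ∀ {Q : Fin (suc n) → Set} (Q? : Decidable Q) →
                              sumℚ G (map indicator₀ (filter Q? (tabulate Fin.suc))) ≡ 0ℚ
    nonzero-vertices-vanish Q? = sum-zeros indicator₀ (filter⁺ Q? (tabulate⁺ {f = Fin.suc} (λ _ → refl)))

  classSum-indicator₀-hit : ∀ {v j} → dist G v Fin.zero ≡ j → classSum G indicator₀ v j ≡ 1ℚ
  classSum-indicator₀-hit {v} {j} hit = begin
    classSum G indicator₀ v j
      ≡⟨ cong (sumℚ G ∘ map indicator₀) (filter-accept at-j? hit) ⟩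
    1ℚ +ℚ sumℚ G (map indicator₀ (filter at-j? (tabulate Fin.suc)))
      ≡⟨ cong (1ℚ +ℚ_) (nonzero-vertices-vanish at-j?) ⟩
    1ℚ +ℚ 0ℚ
      ≡⟨ ℚ.+-identityʳ 1ℚ ⟩
    1ℚ
      ∎
    where
    open ≡-Reasoning
    at-j? = λ w → dist G v w ℕ.≟ j

  classSum-indicator₀-miss : ∀ {v j} → dist G v Fin.zero ≢ j → classSum G indicator₀ v j ≡ 0ℚ
  classSum-indicator₀-miss {v} {j} miss =
    trans (cong (sumℚ G ∘ map indicator₀) (filter-reject at-j? miss)) (nonzero-vertices-vanish at-j?)
    where
    at-j? = λ w → dist G v w ℕ.≟ j

  string-indicator₀-determines-dist : ∀ v w {k} → dist G v Fin.zero ≡ suc k →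
    string G indicator₀ v ≡ string G indicator₀ w → dist G w Fin.zero ≡ suc k
  string-indicator₀-determines-dist v w {k} dv same with dist G w Fin.zero ℕ.≟ suc k
  ... | yes dw = dw
  ... | no dw≢ = ⊥-elim (1≢0 (begin
    1ℚ                                 ≡⟨ classSum-indicator₀-hit {v} dv ⟨
    classSum G indicator₀ v (suc k)    ≡⟨ string-≡⁻ G {indicator₀} {v} {w} same k<diam ⟩
    classSum G indicator₀ w (suc k)    ≡⟨ classSum-indicator₀-miss {w} dw≢ ⟩
    0ℚ                                 ∎))
    where
    open ≡-Reasoning
    k<diam = subst (_≤ diam G) dv (dist≤diam G v Fin.zero)

  string-indicator₀⇒dist-zero-≡ : ∀ v w → string G indicator₀ v ≡ string G indicator₀ w →
                                  dist G v Fin.zero ≡ dist G w Fin.zero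
  string-indicator₀⇒dist-zero-≡ v w same = agree _ _ refl refl
    where
    -- Splitting with `with` would also abstract the distances inside the type of same.
    agree : ∀ a b → dist G v Fin.zero ≡ a → dist G w Fin.zero ≡ b → dist G v Fin.zero ≡ dist G w Fin.zero
    agree zero    zero    dv dw = trans dv (sym dw)
    agree (suc k) _       dv _  = trans dv (sym (string-indicator₀-determines-dist v w dv same))
    agree zero    (suc k) _  dw = trans (string-indicator₀-determines-dist w v dw (sym same)) (sym dw)

  indicator₀-distinguishing : (∀ v w → dist G v Fin.zero ≡ dist G w Fin.zero → v ≡ w) →
                              Distinguishing G indicator₀
  indicator₀-distinguishing resolving v w v≢w = v≢w ∘ resolving v w ∘ string-indicator₀⇒dist-zero-≡ v w

imageSize-indicator₀ : ∀ {n} → imageSize (indicator₀ {suc n}) ≡ 2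
imageSize-indicator₀ {n} = cong length (begin
  deduplicate ℚ._≟_ (1ℚ ∷ 0ℚ ∷ zeros)
    ≡⟨⟩
  1ℚ ∷ filter (¬? ∘ (1ℚ ℚ.≟_)) (0ℚ ∷ filter (¬? ∘ (0ℚ ℚ.≟_)) (deduplicate ℚ._≟_ zeros))
    ≡⟨ cong (λ ys → 1ℚ ∷ filter (¬? ∘ (1ℚ ℚ.≟_)) (0ℚ ∷ ys)) (filter-none (¬? ∘ (0ℚ ℚ.≟_)) zeros-removed) ⟩
  1ℚ ∷ filter (¬? ∘ (1ℚ ℚ.≟_)) (0ℚ ∷ [])
    ≡⟨ cong (1ℚ ∷_) (filter-accept (¬? ∘ (1ℚ ℚ.≟_)) {xs = []} 1≢0) ⟩
  1ℚ ∷ 0ℚ ∷ []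
    ∎)
  where
  open ≡-Reasoning
  zeros = map indicator₀ (tabulate {n = n} (Fin.suc ∘ Fin.suc))
  zeros-removed : All (λ y → ¬ (0ℚ ≢ y)) (deduplicate ℚ._≟_ zeros)
  zeros-removed = All.map (λ y≡0 0≢y → 0≢y (sym y≡0)) (deduplicate⁺ ℚ._≟_ (map⁺ (tabulate⁺ (λ _ → refl))))

imageSize≤1⇒constant : ∀ {n} (f : Fin (suc n) → ℚ) → imageSize f ≤ 1 → ∀ x → f x ≡ f Fin.zero
imageSize≤1⇒constant f size≤1 x = ∈-length≤1⇒≡ (value∈image x) (value∈image Fin.zero) size≤1
  where
  value∈image : ∀ x → f x ∈ deduplicate ℚ._≟_ (map f (allFin _))
  value∈image x = ∈-deduplicate⁺ ℚ._≟_ (∈-map⁺ f (∈-allFin x))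

Adjacent : ℕ → ℕ → Set
Adjacent a b = suc a ≡ b ⊎ suc b ≡ a

∣n-1+n∣≡1 : ∀ a → ∣ a - suc a ∣ ≡ 1
∣n-1+n∣≡1 zero = refl
∣n-1+n∣≡1 (suc a) = ∣n-1+n∣≡1 a

adjacent⇒∣-∣≡1 : ∀ {a b} → Adjacent a b → ∣ a - b ∣ ≡ 1
adjacent⇒∣-∣≡1 {a} (inj₁ refl) = ∣n-1+n∣≡1 a
adjacent⇒∣-∣≡1 {b = b} (inj₂ refl) = trans (ℕ.∣-∣-comm (suc b) b) (∣n-1+n∣≡1 b)

∣-∣≡1+⇒closer-adjacent : ∀ a b {k} → ∣ a - b ∣ ≡ suc k → ∃[ c ] (∣ a - c ∣ ≡ k × Adjacent c b × c ≤ a ⊔ b)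
∣-∣≡1+⇒closer-adjacent zero    (suc b) refl = b , refl , inj₁ refl , ℕ.n≤1+n b
∣-∣≡1+⇒closer-adjacent (suc a) zero    refl = 1 , ℕ.∣-∣-identityʳ a , inj₂ refl , s≤s z≤n
∣-∣≡1+⇒closer-adjacent (suc a) (suc b) a-b≡1+k with ∣-∣≡1+⇒closer-adjacent a b a-b≡1+k
... | c , a-c≡k , c~b , c≤a⊔b = suc c , a-c≡k , Sum.map (cong suc) (cong suc) c~b , s≤s c≤a⊔b

module _ {n : ℕ} where

  adj-path⁻ : ∀ {u w} → T (adj (path n) u w) → Adjacent (toℕ u) (toℕ w)
  adj-path⁻ {u} {w} =
    Sum.map (toWitness {a? = suc (toℕ u) ℕ.≟ toℕ w}) (toWitness {a? = suc (toℕ w) ℕ.≟ toℕ u}) ∘ to T-∨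

  adj-path⁺ : ∀ {u w} → Adjacent (toℕ u) (toℕ w) → T (adj (path n) u w)
  adj-path⁺ {u} {w} =
    from T-∨ ∘ Sum.map (fromWitness {a? = suc (toℕ u) ℕ.≟ toℕ w}) (fromWitness {a? = suc (toℕ w) ℕ.≟ toℕ u})

  closer-neighbour : ∀ (v w : Fin n) {k} → ∣ toℕ v - toℕ w ∣ ≡ suc k →
                     ∃[ u ] (∣ toℕ v - toℕ u ∣ ≡ k × Adjacent (toℕ u) (toℕ w))
  closer-neighbour v w v-w≡1+k with ∣-∣≡1+⇒closer-adjacent (toℕ v) (toℕ w) v-w≡1+k
  ... | c , v-c≡k , c~w , c≤v⊔w =
    fromℕ< c<n , subst (λ x → ∣ toℕ v - x ∣ ≡ _ × Adjacent x (toℕ w)) (sym (toℕ-fromℕ< c<n)) (v-c≡k , c~w)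
    where
    c<n = ℕ.≤-<-trans c≤v⊔w (ℕ.⊔-lub (toℕ<n v) (toℕ<n w))

  reach-path⁻ : ∀ k v w → T (reach (path n) k v w) → ∣ toℕ v - toℕ w ∣ ≤ k
  reach-path⁻ zero v w r = ≤-reflexive (ℕ.m≡n⇒∣m-n∣≡0 (cong toℕ (toWitness r)))
  reach-path⁻ (suc k) v w r with reach-suc⁻ (path n) {k} {v} {w} r
  ... | inj₁ r′ = ℕ.m≤n⇒m≤1+n (reach-path⁻ k v w r′)
  ... | inj₂ (u , r′ , u~w) = begin
    ∣ toℕ v - toℕ w ∣                    ≤⟨ ℕ.∣-∣-triangle (toℕ v) (toℕ u) (toℕ w) ⟩
    ∣ toℕ v - toℕ u ∣ + ∣ toℕ u - toℕ w ∣ ≤⟨ ℕ.+-mono-≤ (reach-path⁻ k v u r′) (≤-reflexive u-w≡1) ⟩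
    k + 1                                ≡⟨ ℕ.+-comm k 1 ⟩
    suc k                                ∎
    where
    open ℕ.≤-Reasoning
    u-w≡1 = adjacent⇒∣-∣≡1 (adj-path⁻ {u} {w} u~w)

  reach-path⁺ : ∀ k v w → ∣ toℕ v - toℕ w ∣ ≤ k → T (reach (path n) k v w)
  reach-path⁺ zero v w v-w≤0 = fromWitness (toℕ-injective (ℕ.∣m-n∣≡0⇒m≡n (ℕ.n≤0⇒n≡0 v-w≤0)))
  reach-path⁺ (suc k) v w v-w≤1+k with m≤n⇒m<n∨m≡n v-w≤1+k
  ... | inj₁ v-w<1+k = reach-mono (path n) {k} {v} {w} (reach-path⁺ k v w (s≤s⁻¹ v-w<1+k))
  ... | inj₂ v-w≡1+k with closer-neighbour v w v-w≡1+k
  ...   | u , v-u≡k , u~w =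
    reach-step (path n) {k} {v} {u} {w} (reach-path⁺ k v u (≤-reflexive v-u≡k)) (adj-path⁺ {u} {w} u~w)

  dist-path : ∀ v w → dist (path n) v w ≡ ∣ toℕ v - toℕ w ∣
  dist-path v w = dist-unique (path n) v-w≤n (λ k → mk⇔ (reach-path⁻ k v w) (reach-path⁺ k v w))
    where
    v-w≤n = ℕ.<⇒≤ (ℕ.≤-<-trans (ℕ.∣m-n∣≤m⊔n (toℕ v) (toℕ w)) (ℕ.⊔-lub (toℕ<n v) (toℕ<n w)))

dist-path-zeroʳ-injective : ∀ {n} (v w : Fin (suc n)) →
  dist (path (suc n)) v Fin.zero ≡ dist (path (suc n)) w Fin.zero → v ≡ w
dist-path-zeroʳ-injective v w same = toℕ-injective (begin
  toℕ v                            ≡⟨ ℕ.∣-∣-identityʳ (toℕ v) ⟨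
  ∣ toℕ v - 0 ∣                    ≡⟨ dist-path v Fin.zero ⟨
  dist (path _) v Fin.zero         ≡⟨ same ⟩
  dist (path _) w Fin.zero         ≡⟨ dist-path w Fin.zero ⟩
  ∣ toℕ w - 0 ∣                    ≡⟨ ℕ.∣-∣-identityʳ (toℕ w) ⟩
  toℕ w                            ∎)
  where open ≡-Reasoning

dist-path-last : ∀ {n} (x : Fin (suc n)) → dist (path (suc n)) (fromℕ n) x ≡ dist (path (suc n)) Fin.zero (opposite x)
dist-path-last {n} x = begin
  dist (path (suc n)) (fromℕ n) x          ≡⟨ dist-path (fromℕ n) x ⟩
  ∣ toℕ (fromℕ n) - toℕ x ∣                ≡⟨ cong (λ m → ∣ m - toℕ x ∣) (toℕ-fromℕ n) ⟩
  ∣ n - toℕ x ∣                            ≡⟨ ℕ.m≤n⇒∣n-m∣≡n∸m (toℕ≤pred[n] x) ⟩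
  n ℕ.∸ toℕ x                              ≡⟨ opposite-prop x ⟨
  toℕ (opposite x)                         ≡⟨ dist-path Fin.zero (opposite x) ⟨
  dist (path (suc n)) Fin.zero (opposite x) ∎
  where open ≡-Reasoning

module _ {n : ℕ} {f : Fin (suc n) → ℚ} {c : ℚ} (f≡c : ∀ x → f x ≡ c) where

  private
    Pₙ = path (suc n)

    at? : ∀ e j → Decidable (λ x → dist Pₙ e x ≡ j)
    at? e j x = dist Pₙ e x ℕ.≟ j

  -- Every distance class of the end 0 is a singleton or empty, and σ carries it to the class of e.
  classSum-constant-reflected : ∀ e (σ : Fin (suc n) → Fin (suc n)) → (∀ x → σ (σ x) ≡ x) →
    (∀ x → dist Pₙ e x ≡ dist Pₙ Fin.zero (σ x)) → ∀ j → classSum Pₙ f Fin.zero j ≡ classSum Pₙ f e j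
  classSum-constant-reflected e σ σ-involutive dist-e j with j ℕ.≤? n
  ... | yes j≤n = begin
    classSum Pₙ f Fin.zero j  ≡⟨ cong (sumℚ Pₙ ∘ map f) (filter-tabulate-unique (at? Fin.zero j) id at-a at-zero⇒a) ⟩
    f a +ℚ 0ℚ                 ≡⟨ cong (_+ℚ 0ℚ) (trans (f≡c a) (sym (f≡c (σ a)))) ⟩
    f (σ a) +ℚ 0ℚ             ≡⟨ cong (sumℚ Pₙ ∘ map f) (filter-tabulate-unique (at? e j) id at-σa at-e⇒σa) ⟨
    classSum Pₙ f e j         ∎
    where
    open ≡-Reasoning
    a = fromℕ< (s≤s j≤n)
    at-a : dist Pₙ Fin.zero a ≡ j
    at-a = trans (dist-path Fin.zero a) (toℕ-fromℕ< (s≤s j≤n))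
    at-zero⇒a : ∀ x → dist Pₙ Fin.zero x ≡ j → x ≡ a
    at-zero⇒a x at-x = toℕ-injective (trans (trans (sym (dist-path Fin.zero x)) at-x) (sym (toℕ-fromℕ< (s≤s j≤n))))
    at-σa : dist Pₙ e (σ a) ≡ j
    at-σa = trans (dist-e (σ a)) (trans (cong (dist Pₙ Fin.zero) (σ-involutive a)) at-a)
    at-e⇒σa : ∀ x → dist Pₙ e x ≡ j → x ≡ σ a
    at-e⇒σa x at-x = trans (sym (σ-involutive x)) (cong σ (at-zero⇒a (σ x) (trans (sym (dist-e x)) at-x)))
  ... | no j≰n = cong (sumℚ Pₙ ∘ map f) (trans (filter-none (at? Fin.zero j) (tabulate⁺ {f = id} not-at))
                                               (sym (filter-none (at? e j) (tabulate⁺ {f = id} not-at-e))))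
    where
    not-at : ∀ x → dist Pₙ Fin.zero x ≢ j
    not-at x at-x = j≰n (subst (_≤ n) (trans (sym (dist-path Fin.zero x)) at-x) (toℕ≤pred[n] x))
    not-at-e : ∀ x → dist Pₙ e x ≢ j
    not-at-e x = not-at (σ x) ∘ trans (sym (dist-e x))

path-distinguishing⇒2≤imageSize : ∀ {n} (f : Fin (suc (suc n)) → ℚ) →
  Distinguishing (path (suc (suc n))) f → 2 ≤ imageSize f
path-distinguishing⇒2≤imageSize {n} f distinguishing = ℕ.≮⇒≥ λ size<2 →
  let f-constant = imageSize≤1⇒constant f (s≤s⁻¹ size<2)
      ends-agree = classSum-constant-reflected f-constant (fromℕ (suc n)) opposite opposite-involutive dist-path-last
  in distinguishing Fin.zero (fromℕ (suc n)) 0≢1+n (string-≡⁺ (path _) {f} {Fin.zero} {fromℕ (suc n)} ends-agree)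

mainTheorem6 : ∀ (n : ℕ) → 2 ≤ n → IDI≡ (path n) 2
mainTheorem6 (suc (suc n)) _ =
  (indicator₀ , imageSize-indicator₀ {n} , indicator₀-distinguishing (path _) dist-path-zeroʳ-injective)
  , path-distinguishing⇒2≤imageSize
mainTheorem6 (suc zero) (s≤s ())
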